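{- For any $n\geq1$, both $M_n(x)$ and $N_n(x)$ are alternatingly increasing; consequently each is unimodal, with a mode at index $\lfloor (d+1)/2\rfloor$ where $d$ is its degree (modes in the middle).
   Context: A Stirling permutation of order $n$ is a permutation $\sigma=\sigma_1\cdots\sigma_{2n}$ of the multiset $\{1,1,2,2,\ldots,n,n\}$ such that for each $i$ all entries between the two occurrences of $i$ are larger than $i$; $\mathcal{Q}_n$ is the set of these. Define ${\rm ap}(\sigma)=\#\{i\in[2,2n-1]:\sigma_{i-1}<\sigma_i=\sigma_{i+1}\}$ and ${\rm lap}(\sigma)=\#\{i\in[2n-1]:\sigma_{i-1}<\sigma_i=\sigma_{i+1}\}$ with the convention $\sigma_0=0$. Let $M_n(x)=\sum_{\sigma\in\mathcal{Q}_n}x^{{\rm ap}(\sigma)}$ and $N_n(x)=\sum_{\sigma\in\mathcal{Q}_n}x^{{\rm lap}(\sigma)}$. A polynomial $f(x)=\sum_{i=0}^d f_ix^i$ of degree $d$ is alternatingly increasing if $f_0\le f_d\le f_1\le f_{d-1}\le\cdots\le f_{\lfloor (d+1)/2\rfloor}$. It is unimodal if $f_0\le\cdots\le f_k\ge f_{k+1}\ge\cdots\ge f_d$ for some $k$ (a mode). -}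

module Defs where

open import Data.Nat using (ℕ; zero; suc; _+_; _∸_; _*_; _≤_; _<_; _/_)
open import Data.Nat.Properties using (_≟_; _<?_)
open import Data.Fin using (Fin; toℕ) renaming (_<_ to _<ᶠ_; _<?_ to _<ᶠ?_)
open import Data.Fin.Properties using (all?)
open import Data.List using (List; []; _∷_; length; map; filter; concatMap; applyUpTo; lookup)
open import Data.Product using (_×_)
open import Relation.Binary.PropositionalEquality using (_≡_)
open import Relation.Nullary using (Dec; yes; no; ¬_)
open import Relation.Nullary.Decidable using (_×-dec_; _→-dec_)
open import Relation.Unary using (Decidable)

occ : ℕ → List ℕ → ℕ
occ v σ = length (filter (_≟ v) σ)

IsMultisetPerm : ℕ → List ℕ → Set
IsMultisetPerm n σ = (length σ ≡ 2 * n) × ((i : Fin n) → occ (suc (toℕ i)) σ ≡ 2)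

StirlingCond : List ℕ → Set
StirlingCond σ = (p q r : Fin (length σ)) → p <ᶠ q → q <ᶠ r →
  lookup σ p ≡ lookup σ r → lookup σ p < lookup σ q

IsStirling : ℕ → List ℕ → Set
IsStirling n σ = IsMultisetPerm n σ × StirlingCond σ

isStirling? : (n : ℕ) → Decidable (IsStirling n)
isStirling? n σ =
  ((length σ ≟ 2 * n) ×-dec all? (λ i → occ (suc (toℕ i)) σ ≟ 2))
  ×-dec all? (λ p → all? (λ q → all? (λ r →
          (p <ᶠ? q) →-dec ((q <ᶠ? r) →-dec
            ((lookup σ p ≟ lookup σ r) →-dec (lookup σ p <? lookup σ q))))))

words : ℕ → ℕ → List (List ℕ)
words zero    n = [] ∷ []
words (suc k) n = concatMap (λ v → map (v ∷_) (words k n)) (applyUpTo suc n)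

Q : ℕ → List (List ℕ)
Q n = filter (isStirling? n) (words (2 * n) n)

-- ap(σ): number of i with σ_{i-1} < σ_i = σ_{i+1}, i ranging over [2, 2n-1]
-- (consecutive triples of σ).
-- indicator of σ_{i-1} < σ_i = σ_{i+1} for a triple (a, b, c)
peak : ℕ → ℕ → ℕ → ℕ
peak a b c with a <? b | b ≟ c
... | yes _ | yes _ = 1
... | _     | _     = 0

ap : List ℕ → ℕ
ap (a ∷ b ∷ c ∷ rest) = peak a b c + ap (b ∷ c ∷ rest)
ap _ = 0

lap : List ℕ → ℕ
lap σ = ap (0 ∷ σ)

-- Coefficient of x^k in M_n(x) and N_n(x).
M : ℕ → ℕ → ℕ
M n k = length (filter (λ σ → ap σ ≟ k) (Q n))

N : ℕ → ℕ → ℕ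
N n k = length (filter (λ σ → lap σ ≟ k) (Q n))

-- A polynomial is given by its coefficient function f : ℕ → ℕ.
-- d is its degree.
IsDegree : (ℕ → ℕ) → ℕ → Set
IsDegree f d = ¬ (f d ≡ 0) × ((k : ℕ) → d < k → f k ≡ 0)

-- Alternatingly increasing (of degree d):
-- f_0 ≤ f_d ≤ f_1 ≤ f_{d-1} ≤ ... ≤ f_{⌊(d+1)/2⌋}, i.e. the sequence
-- a_{2i} = f_i, a_{2i+1} = f_{d-i} (0 ≤ j ≤ d) is weakly increasing.
AltIncreasing : (ℕ → ℕ) → ℕ → Set
AltIncreasing f d =
  ((i : ℕ) → 2 * i + 1 ≤ d → f i ≤ f (d ∸ i)) ×
  ((i : ℕ) → 2 * i + 2 ≤ d → f (d ∸ i) ≤ f (suc i))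

UnimodalWithMode : (ℕ → ℕ) → ℕ → ℕ → Set
UnimodalWithMode f d m =
  (m ≤ d) ×
  ((i : ℕ) → i < m → f i ≤ f (suc i)) ×
  ((i : ℕ) → m ≤ i → i < d → f (suc i) ≤ f i)

AltIncAndMiddleMode : (ℕ → ℕ) → Set
AltIncAndMiddleMode f = (d : ℕ) → IsDegree f d →
  AltIncreasing f d × UnimodalWithMode f d ((d + 1) / 2)

-- Every Stirling permutation of order n + 1 arises exactly once by inserting the adjacent pair
-- (n + 1)(n + 1) into one of the 2n + 1 gaps of a Stirling permutation σ of order n.  Such an
-- insertion raises ap by one, except in the gap before and the gap inside each ascent plateau
-- of σ and in the front gap, where ap is unchanged; for lap the front gap is not special, since
-- σ₀ = 0.  Hence
--   M (n+1) k = (2k + 1) M n k + (2n − 2k + 2) M n (k − 1),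
--   N (n+1) k = 2k N n k + (2n − 2k + 3) N n (k − 1),
-- so M (n+1) and N n have degree n.  A recurrence of this shape preserves alternating increase,
-- because every inequality in the alternating chain of the new coefficients is a positive
-- combination of two neighbouring inequalities in the old chain.  The chain f₀ ≤ f_d ≤ f₁ ≤ ⋯
-- ends at the middle index ⌊(d + 1)/2⌋, and read in index order it rises up to there and falls
-- after.

module Submission where

open import Defs
open import Data.Nat using (ℕ; zero; suc; _+_; _*_; _∸_; _≤_; _<_; _≥_; _/_; _%_; z≤n; s≤s)
open import Data.Nat.Properties
open import Relation.Binary.Definitions using (tri<; tri≈; tri>)
open import Data.Nat.DivMod using (m/n*n≤m; m≡m%n+[m/n]*n; m%n<n)
open import Data.Nat.Tactic.RingSolver using (solve-∀)
open import Data.Fin using (Fin; toℕ; fromℕ<; inject₁) renaming (zero to fzero; suc to fsuc; _<_ to _<ᶠ_)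
open import Data.Fin.Properties using (toℕ-fromℕ<; toℕ-inject₁; toℕ<n)
open import Data.Product using (_×_; _,_; proj₁; proj₂)
open import Data.Sum using (_⊎_; inj₁; inj₂)
import Data.Sum as Sum
open import Data.Unit using (⊤; tt)
open import Data.Empty using (⊥; ⊥-elim)
open import Data.List using (List; []; _∷_; length; map; filter; concatMap; applyUpTo; _++_; lookup)
open import Data.List.Properties
  using (length-++; length-++-sucʳ; length-map; filter-++; filter-≐; filter-accept; filter-reject; filter-all; filter-none;
         ∷-injectiveˡ; ∷-injectiveʳ)
open import Data.List.Membership.Propositional using (_∈_; _∉_; lose; find)
open import Data.List.Membership.Propositional.Properties
  using (∈-∃++; ∈-++⁻; ∈-++⁺ˡ; ∈-++⁺ʳ; ∈-filter⁺; ∈-filter⁻; ∈-concatMap⁺; ∈-concatMap⁻; ∈-map⁺; ∈-map⁻;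
         ∈-applyUpTo⁺; ∈-applyUpTo⁻; ∈-lookup)
open import Data.List.Membership.DecPropositional _≟_ using (_∈?_)
open import Data.List.Relation.Unary.Any using (Any; here; there; index)
open import Data.List.Relation.Unary.Any.Properties using (lookup-index)
open import Data.List.Relation.Unary.All as All using (All; []; _∷_)
open import Data.List.Relation.Unary.Unique.Propositional using (Unique; []; _∷_)
import Data.List.Relation.Unary.Unique.Propositional.Properties as Unique
open import Relation.Binary.PropositionalEquality
open import Relation.Nullary using (Dec; yes; no; ¬_; ¬?)
open import Relation.Unary using (Pred; Decidable)
open import Level using (0ℓ)

module _ {A : Set} where

  unique-⊆⇒length≤ : {xs ys : List A} → Unique xs → (∀ {z} → z ∈ xs → z ∈ ys) → length xs ≤ length ys
  unique-⊆⇒length≤ {[]}     _          _     = z≤n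
  unique-⊆⇒length≤ {x ∷ xs} (x∉xs ∷ u) xs⊆ys with as , bs , refl ← ∈-∃++ (xs⊆ys (here refl)) =
    ≤-trans (s≤s (unique-⊆⇒length≤ u xs⊆as++bs)) (≤-reflexive (sym (length-++-sucʳ as x bs)))
    where
      xs⊆as++bs : ∀ {z} → z ∈ xs → z ∈ as ++ bs
      xs⊆as++bs z∈xs with ∈-++⁻ as (xs⊆ys (there z∈xs))
      ... | inj₁ z∈as         = ∈-++⁺ˡ z∈as
      ... | inj₂ (here refl)  = ⊥-elim (All.lookup x∉xs z∈xs refl)
      ... | inj₂ (there z∈bs) = ∈-++⁺ʳ as z∈bs

  unique-⊆⊇⇒length-filter≡ : {P : Pred A 0ℓ} (P? : Decidable P) {xs ys : List A} → Unique xs → Unique ys →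
    (∀ {z} → z ∈ xs → z ∈ ys) → (∀ {z} → z ∈ ys → z ∈ xs) →
    length (filter P? xs) ≡ length (filter P? ys)
  unique-⊆⊇⇒length-filter≡ P? ux uy xs⊆ys ys⊆xs =
    ≤-antisym (unique-⊆⇒length≤ (Unique.filter⁺ P? ux) (filter-mono xs⊆ys))
              (unique-⊆⇒length≤ (Unique.filter⁺ P? uy) (filter-mono ys⊆xs))
    where
      filter-mono : ∀ {as bs} → (∀ {z} → z ∈ as → z ∈ bs) → ∀ {z} → z ∈ filter P? as → z ∈ filter P? bs
      filter-mono {as} as⊆bs z∈ with z∈as , Pz ← ∈-filter⁻ P? {xs = as} z∈ = ∈-filter⁺ P? (as⊆bs z∈as) Pz

  Unique-concatMap : ∀ {B : Set} (f : A → List B) {xs : List A} → Unique xs → (∀ {x} → x ∈ xs → Unique (f x)) →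
    (∀ {x y z} → x ∈ xs → y ∈ xs → z ∈ f x → z ∈ f y → x ≡ y) → Unique (concatMap f xs)
  Unique-concatMap f {[]}     _          _     _        = []
  Unique-concatMap f {x ∷ xs} (x∉xs ∷ u) uniqF disjoint =
    Unique.++⁺ (uniqF (here refl))
               (Unique-concatMap f u (λ m → uniqF (there m)) (λ m m' → disjoint (there m) (there m')))
               (λ (z∈fx , z∈rest) → outside xs x∉xs (λ m → m) z∈fx (∈-concatMap⁻ f z∈rest))
    where
      outside : ∀ {z} ys → All (x ≢_) ys → (∀ {y} → y ∈ ys → y ∈ xs) → z ∈ f x → ¬ Any (λ y → z ∈ f y) ys
      outside (y ∷ ys) (x≢y ∷ _)  ys⊆xs z∈fx (here z∈fy) = x≢y (disjoint (here refl) (there (ys⊆xs (here refl))) z∈fx z∈fy)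
      outside (y ∷ ys) (_ ∷ x∉ys) ys⊆xs z∈fx (there any) = outside ys x∉ys (λ m → ys⊆xs (there m)) z∈fx any

𝟙 : {P : Set} → Dec P → ℕ
𝟙 (yes _) = 1
𝟙 (no _)  = 0

𝟙-≡ : ∀ {m n} → m ≡ n → 𝟙 (m ≟ n) ≡ 1
𝟙-≡ {m} {n} m≡n with m ≟ n
... | yes _   = refl
... | no m≢n = ⊥-elim (m≢n m≡n)

𝟙-≢ : ∀ {m n} → m ≢ n → 𝟙 (m ≟ n) ≡ 0
𝟙-≢ {m} {n} m≢n with m ≟ n
... | yes m≡n = ⊥-elim (m≢n m≡n)
... | no _    = refl

length-filter-∷ : {A : Set} {P : Pred A 0ℓ} (P? : Decidable P) (x : A) (xs : List A) →
  length (filter P? (x ∷ xs)) ≡ 𝟙 (P? x) + length (filter P? xs)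
length-filter-∷ P? x xs with P? x
... | yes _ = refl
... | no _  = refl

#[_≡_] : {A : Set} → (A → ℕ) → ℕ → List A → ℕ
#[ h ≡ k ] xs = length (filter (λ x → h x ≟ k) xs)

#-∷ : {A : Set} (h : A → ℕ) (k : ℕ) (x : A) (xs : List A) → #[ h ≡ k ] (x ∷ xs) ≡ 𝟙 (h x ≟ k) + #[ h ≡ k ] xs
#-∷ h k = length-filter-∷ (λ x → h x ≟ k)

#-map : {A B : Set} (h : B → ℕ) (f : A → B) (k : ℕ) (xs : List A) → #[ h ≡ k ] (map f xs) ≡ #[ (λ x → h (f x)) ≡ k ] xs
#-map h f k []       = refl
#-map h f k (x ∷ xs) =
  trans (#-∷ h k (f x) (map f xs)) (trans (cong (𝟙 (h (f x) ≟ k) +_) (#-map h f k xs)) (sym (#-∷ (λ x → h (f x)) k x xs)))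

module _ {A : Set} (h : A → ℕ) where

  #-++ : ∀ k xs ys → #[ h ≡ k ] (xs ++ ys) ≡ #[ h ≡ k ] xs + #[ h ≡ k ] ys
  #-++ k xs ys = trans (cong length (filter-++ (λ x → h x ≟ k) xs ys)) (length-++ (filter (λ x → h x ≟ k) xs))

  #-+ˡ : ∀ m k xs → #[ (λ x → m + h x) ≡ m + k ] xs ≡ #[ h ≡ k ] xs
  #-+ˡ m k xs = cong length (filter-≐ (λ x → m + h x ≟ m + k) (λ x → h x ≟ k) (+-cancelˡ-≡ m _ _ , cong (m +_)) xs)

  #-cong : ∀ {h′ : A → ℕ} {k k′} → (∀ x → h x ≡ h′ x) → k ≡ k′ → ∀ xs → #[ h ≡ k ] xs ≡ #[ h′ ≡ k′ ] xs
  #-cong h≗h′ k≡k′ xs = cong length (filter-≐ (λ x → h x ≟ _) (λ x → _ ≟ _)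
    ((λ {x} e → trans (sym (h≗h′ x)) (trans e k≡k′)) , (λ {x} e → trans (h≗h′ x) (trans e (sym k≡k′)))) xs)

  TwoValued : ℕ → List A → Set
  TwoValued o xs = ∀ {x} → x ∈ xs → h x ≡ o ⊎ h x ≡ suc o

  #-outside : ∀ {o k} xs → TwoValued o xs → k ≢ o → k ≢ suc o → #[ h ≡ k ] xs ≡ 0
  #-outside []       _  _   _     = refl
  #-outside {k = k} (x ∷ xs) tv k≢o k≢1+o rewrite #-∷ h k x xs with h x ≟ k | tv (here refl)
  ... | yes e | inj₁ e′ = ⊥-elim (k≢o (trans (sym e) e′))
  ... | yes e | inj₂ e′ = ⊥-elim (k≢1+o (trans (sym e) e′))
  ... | no _  | _       = #-outside xs (λ m → tv (there m)) k≢o k≢1+o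

  #-split : ∀ {o} xs → TwoValued o xs → #[ h ≡ o ] xs + #[ h ≡ suc o ] xs ≡ length xs
  #-split []       _  = refl
  #-split {o} (x ∷ xs) tv rewrite #-∷ h o x xs | #-∷ h (suc o) x xs with h x ≟ o | h x ≟ suc o | tv (here refl)
  ... | yes e | yes e′ | _      = ⊥-elim (1+n≢n (trans (sym e′) e))
  ... | yes _ | no _   | _      = cong suc (#-split xs (λ m → tv (there m)))
  ... | no _  | yes _  | _      = trans (+-suc _ _) (cong suc (#-split xs (λ m → tv (there m))))
  ... | no ¬e | no _   | inj₁ e = ⊥-elim (¬e e)
  ... | no _  | no ¬e  | inj₂ e = ⊥-elim (¬e e)

module _ {A : Set} (h : A → ℕ) (children : A → List A) (L : ℕ) (E : ℕ → ℕ) where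

  ChildProfile : A → Set
  ChildProfile x = length (children x) ≡ L × TwoValued h (h x) (children x) × #[ h ≡ h x ] (children x) ≡ E (h x)

  private
    #-children-kept : ∀ {x o} → h x ≡ o → ChildProfile x → #[ h ≡ o ] (children x) ≡ E o
    #-children-kept refl (_ , _ , kept) = kept

    #-children-raised : ∀ {x o} → h x ≡ o → ChildProfile x → #[ h ≡ suc o ] (children x) ≡ L ∸ E o
    #-children-raised {x} refl (len , tv , kept) = begin
      #[ h ≡ suc (h x) ] (children x)
        ≡⟨ sym (m+n∸m≡n (#[ h ≡ h x ] (children x)) _) ⟩
      #[ h ≡ h x ] (children x) + #[ h ≡ suc (h x) ] (children x) ∸ #[ h ≡ h x ] (children x)
        ≡⟨ cong₂ _∸_ (trans (#-split h (children x) tv) len) kept ⟩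
      L ∸ E (h x)
        ∎
      where open ≡-Reasoning

    #-children-zero : ∀ {x} → ChildProfile x → #[ h ≡ 0 ] (children x) ≡ 𝟙 (h x ≟ 0) * E 0
    #-children-zero {x} p@(_ , tv , _) with h x ≟ 0
    ... | yes e = trans (#-children-kept e p) (sym (+-identityʳ (E 0)))
    ... | no ¬e = #-outside h (children x) tv (λ e → ¬e (sym e)) (λ ())

    #-children-suc : ∀ {x} k → ChildProfile x →
      #[ h ≡ suc k ] (children x) ≡ 𝟙 (h x ≟ suc k) * E (suc k) + 𝟙 (h x ≟ k) * (L ∸ E k)
    #-children-suc {x} k p@(_ , tv , _) with h x ≟ suc k | h x ≟ k
    ... | yes e | yes e′ = ⊥-elim (1+n≢n (trans (sym e) e′))
    ... | yes e | no _   = trans (#-children-kept e p) (sym (trans (+-identityʳ (E (suc k) + 0)) (+-identityʳ (E (suc k)))))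
    ... | no _  | yes e  = trans (#-children-raised e p) (sym (+-identityʳ (L ∸ E k)))
    ... | no ¬e | no ¬e′ = #-outside h (children x) tv (λ e → ¬e (sym e)) (λ e → ¬e′ (suc-injective (sym e)))

  #-concatMap-zero : ∀ xs → (∀ {x} → x ∈ xs → ChildProfile x) →
    #[ h ≡ 0 ] (concatMap children xs) ≡ #[ h ≡ 0 ] xs * E 0
  #-concatMap-zero []       _    = refl
  #-concatMap-zero (x ∷ xs) prof = begin
    #[ h ≡ 0 ] (children x ++ concatMap children xs)             ≡⟨ #-++ h 0 (children x) _ ⟩
    #[ h ≡ 0 ] (children x) + #[ h ≡ 0 ] (concatMap children xs) ≡⟨ cong₂ _+_ (#-children-zero (prof (here refl)))
                                                                             (#-concatMap-zero xs (λ m → prof (there m))) ⟩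
    𝟙 (h x ≟ 0) * E 0 + #[ h ≡ 0 ] xs * E 0                     ≡⟨ sym (*-distribʳ-+ (E 0) (𝟙 (h x ≟ 0)) _) ⟩
    (𝟙 (h x ≟ 0) + #[ h ≡ 0 ] xs) * E 0                         ≡⟨ cong (_* E 0) (sym (#-∷ h 0 x xs)) ⟩
    #[ h ≡ 0 ] (x ∷ xs) * E 0                                    ∎
    where open ≡-Reasoning

  #-concatMap-suc : ∀ k xs → (∀ {x} → x ∈ xs → ChildProfile x) →
    #[ h ≡ suc k ] (concatMap children xs) ≡ #[ h ≡ suc k ] xs * E (suc k) + #[ h ≡ k ] xs * (L ∸ E k)
  #-concatMap-suc k []       _    = refl
  #-concatMap-suc k (x ∷ xs) prof = begin
    #[ h ≡ suc k ] (children x ++ concatMap children xs)                 ≡⟨ #-++ h (suc k) (children x) _ ⟩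
    #[ h ≡ suc k ] (children x) + #[ h ≡ suc k ] (concatMap children xs) ≡⟨ cong₂ _+_ (#-children-suc k (prof (here refl)))
                                                                                     (#-concatMap-suc k xs (λ m → prof (there m))) ⟩
    (a₁ * E (suc k) + a₀ * F) + (b₁ * E (suc k) + b₀ * F)                ≡⟨ interchange a₁ a₀ b₁ b₀ (E (suc k)) F ⟩
    (a₁ + b₁) * E (suc k) + (a₀ + b₀) * F                                ≡⟨ cong₂ (λ u w → u * E (suc k) + w * F)
                                                                                     (#-∷ h (suc k) x xs) (#-∷ h k x xs) ⟨
    #[ h ≡ suc k ] (x ∷ xs) * E (suc k) + #[ h ≡ k ] (x ∷ xs) * F        ∎
    where
      open ≡-Reasoning
      F  = L ∸ E k
      a₁ = 𝟙 (h x ≟ suc k)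
      a₀ = 𝟙 (h x ≟ k)
      b₁ = #[ h ≡ suc k ] xs
      b₀ = #[ h ≡ k ] xs
      interchange : ∀ a b c d u w → (a * u + b * w) + (c * u + d * w) ≡ (a + c) * u + (b + d) * w
      interchange = solve-∀

-- Stirling permutations by pair insertion

-- StirlingCond by recursion on the word: ExceedsBefore x σ says that every entry of σ before an
-- occurrence of x exceeds x.
ExceedsBefore : ℕ → List ℕ → Set
ExceedsBefore x []      = ⊤
ExceedsBefore x (y ∷ σ) = (x ∈ σ → x < y) × ExceedsBefore x σ

Stirling : List ℕ → Set
Stirling []      = ⊤
Stirling (x ∷ σ) = ExceedsBefore x σ × Stirling σ

private
  ExceedsBeforeAt : ℕ → List ℕ → Set
  ExceedsBeforeAt x σ = (q r : Fin (length σ)) → q <ᶠ r → lookup σ r ≡ x → x < lookup σ q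

  ExceedsBeforeAt⇒ExceedsBefore : ∀ x σ → ExceedsBeforeAt x σ → ExceedsBefore x σ
  ExceedsBeforeAt⇒ExceedsBefore x []      _ = tt
  ExceedsBeforeAt⇒ExceedsBefore x (y ∷ σ) h =
    (λ x∈σ → h fzero (fsuc (index x∈σ)) (s≤s z≤n) (sym (lookup-index x∈σ))) ,
    ExceedsBeforeAt⇒ExceedsBefore x σ (λ q r q<r → h (fsuc q) (fsuc r) (s≤s q<r))

  ExceedsBefore⇒ExceedsBeforeAt : ∀ x σ → ExceedsBefore x σ → ExceedsBeforeAt x σ
  ExceedsBefore⇒ExceedsBeforeAt x (y ∷ σ) (h , _) fzero    (fsuc r) _         refl = h (∈-lookup r)
  ExceedsBefore⇒ExceedsBeforeAt x (y ∷ σ) (_ , h) (fsuc q) (fsuc r) (s≤s q<r) eq   = ExceedsBefore⇒ExceedsBeforeAt x σ h q r q<r eq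

StirlingCond⇒Stirling : ∀ σ → StirlingCond σ → Stirling σ
StirlingCond⇒Stirling []      _  = tt
StirlingCond⇒Stirling (x ∷ σ) sc =
  ExceedsBeforeAt⇒ExceedsBefore x σ (λ q r q<r eq → sc fzero (fsuc q) (fsuc r) (s≤s z≤n) (s≤s q<r) (sym eq)) ,
  StirlingCond⇒Stirling σ (λ p q r p<q q<r → sc (fsuc p) (fsuc q) (fsuc r) (s≤s p<q) (s≤s q<r))

Stirling⇒StirlingCond : ∀ σ → Stirling σ → StirlingCond σ
Stirling⇒StirlingCond (x ∷ σ) (h , _) fzero    (fsuc q) (fsuc r) _         (s≤s q<r) eq =
  ExceedsBefore⇒ExceedsBeforeAt x σ h q r q<r (sym eq)
Stirling⇒StirlingCond (x ∷ σ) (_ , s) (fsuc p) (fsuc q) (fsuc r) (s≤s p<q) (s≤s q<r) eq =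
  Stirling⇒StirlingCond σ s p q r p<q q<r eq

insertPair : ℕ → List ℕ → List (List ℕ)
insertPair v []      = (v ∷ v ∷ []) ∷ []
insertPair v (t ∷ τ) = (v ∷ v ∷ t ∷ τ) ∷ map (t ∷_) (insertPair v τ)

data InsertPairView (v t : ℕ) (τ ρ : List ℕ) : Set where
  front  : ρ ≡ v ∷ v ∷ t ∷ τ → InsertPairView v t τ ρ
  behind : ∀ {ρ′} → ρ′ ∈ insertPair v τ → ρ ≡ t ∷ ρ′ → InsertPairView v t τ ρ

insertPair-view : ∀ {v t τ ρ} → ρ ∈ insertPair v (t ∷ τ) → InsertPairView v t τ ρ
insertPair-view (here eq) = front eq
insertPair-view {t = t} (there m) with ρ′ , m′ , eq ← ∈-map⁻ (t ∷_) m = behind m′ eq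

∈-insertPair-[] : ∀ {v ρ} → ρ ∈ insertPair v [] → ρ ≡ v ∷ v ∷ []
∈-insertPair-[] (here eq) = eq

pair∈insertPair : ∀ v τ → (v ∷ v ∷ τ) ∈ insertPair v τ
pair∈insertPair v []      = here refl
pair∈insertPair v (t ∷ τ) = here refl

length-insertPair : ∀ v τ → length (insertPair v τ) ≡ suc (length τ)
length-insertPair v []      = refl
length-insertPair v (t ∷ τ) = cong suc (trans (length-map (t ∷_) (insertPair v τ)) (length-insertPair v τ))

∈-insertPair⇒length : ∀ {v} τ {ρ} → ρ ∈ insertPair v τ → length ρ ≡ suc (suc (length τ))
∈-insertPair⇒length []      m rewrite ∈-insertPair-[] m = refl
∈-insertPair⇒length (t ∷ τ) m with insertPair-view m
... | front refl     = refl
... | behind m′ refl = cong suc (∈-insertPair⇒length τ m′)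

∈-insertPair⁻ : ∀ {v} τ {ρ z} → ρ ∈ insertPair v τ → z ∈ ρ → z ≡ v ⊎ z ∈ τ
∈-insertPair⁻ [] m z∈ rewrite ∈-insertPair-[] m with z∈
... | here e         = inj₁ e
... | there (here e) = inj₁ e
∈-insertPair⁻ (t ∷ τ) m z∈ with insertPair-view m | z∈
... | front refl     | here e           = inj₁ e
... | front refl     | there (here e)   = inj₁ e
... | front refl     | there (there z∈τ) = inj₂ z∈τ
... | behind m′ refl | here e           = inj₂ (here e)
... | behind m′ refl | there z∈ρ′ with ∈-insertPair⁻ τ m′ z∈ρ′
...   | inj₁ e   = inj₁ e
...   | inj₂ z∈τ = inj₂ (there z∈τ)

Unique-insertPair : ∀ {v} τ → v ∉ τ → Unique (insertPair v τ)
Unique-insertPair []      _   = [] ∷ []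
Unique-insertPair (t ∷ τ) v∉ =
  All.tabulate (λ m eq → let _ , _ , eq′ = ∈-map⁻ (t ∷_) m in v∉ (here (∷-injectiveˡ (trans eq eq′)))) ∷
  Unique.map⁺ ∷-injectiveʳ (Unique-insertPair τ (λ m → v∉ (there m)))

occ-∷-≡ : ∀ v σ → occ v (v ∷ σ) ≡ suc (occ v σ)
occ-∷-≡ v σ = cong length (filter-accept (_≟ v) refl)

occ-∷-≢ : ∀ {v x} σ → x ≢ v → occ v (x ∷ σ) ≡ occ v σ
occ-∷-≢ {v} σ x≢v = cong length (filter-reject (_≟ v) x≢v)

occ-∉ : ∀ {v σ} → v ∉ σ → occ v σ ≡ 0
occ-∉ {v} v∉σ = cong length (filter-none (_≟ v) (All.tabulate (λ x∈σ x≡v → v∉σ (subst (_∈ _) x≡v x∈σ))))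

∈⇒occ≢0 : ∀ {v σ} → v ∈ σ → occ v σ ≢ 0
∈⇒occ≢0 {v} v∈σ = nonempty (∈-filter⁺ (_≟ v) v∈σ refl)
  where
    nonempty : ∀ {x xs} → x ∈ xs → length xs ≢ 0
    nonempty (here _)  ()
    nonempty (there _) ()

occ≢0⇒∈ : ∀ {v σ} → occ v σ ≢ 0 → v ∈ σ
occ≢0⇒∈ {v} {σ} occ≢0 with v ∈? σ
... | yes v∈σ = v∈σ
... | no v∉σ  = ⊥-elim (occ≢0 (occ-∉ v∉σ))

occ-insertPair : ∀ {v} τ {ρ} → ρ ∈ insertPair v τ → occ v ρ ≡ suc (suc (occ v τ))
occ-insertPair {v} [] m rewrite ∈-insertPair-[] m | occ-∷-≡ v (v ∷ []) | occ-∷-≡ v [] = refl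
occ-insertPair {v} (t ∷ τ) m with insertPair-view m
... | front refl rewrite occ-∷-≡ v (v ∷ t ∷ τ) | occ-∷-≡ v (t ∷ τ) = refl
... | behind {ρ′} m′ refl with t ≟ v
...   | yes refl rewrite occ-∷-≡ v ρ′ | occ-∷-≡ v τ = cong suc (occ-insertPair τ m′)
...   | no t≢v   rewrite occ-∷-≢ ρ′ t≢v | occ-∷-≢ τ t≢v = occ-insertPair τ m′

occ-insertPair-≢ : ∀ {v i} τ {ρ} → i ≢ v → ρ ∈ insertPair v τ → occ i ρ ≡ occ i τ
occ-insertPair-≢ {v} {i} [] i≢v m
  rewrite ∈-insertPair-[] m | occ-∷-≢ (v ∷ []) (≢-sym i≢v) | occ-∷-≢ {i} [] (≢-sym i≢v) = refl
occ-insertPair-≢ {v} {i} (t ∷ τ) i≢v m with insertPair-view m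
... | front refl rewrite occ-∷-≢ (v ∷ t ∷ τ) (≢-sym i≢v) | occ-∷-≢ (t ∷ τ) (≢-sym i≢v) = refl
... | behind {ρ′} m′ refl with t ≟ i
...   | yes refl rewrite occ-∷-≡ t ρ′ | occ-∷-≡ t τ = cong suc (occ-insertPair-≢ τ i≢v m′)
...   | no t≢i   rewrite occ-∷-≢ ρ′ t≢i | occ-∷-≢ τ t≢i = occ-insertPair-≢ τ i≢v m′

erase : ℕ → List ℕ → List ℕ
erase v = filter (λ x → ¬? (x ≟ v))

erase-∷-≡ : ∀ v σ → erase v (v ∷ σ) ≡ erase v σ
erase-∷-≡ v σ = filter-reject (λ x → ¬? (x ≟ v)) (λ v≢v → v≢v refl)

erase-∷-≢ : ∀ {v x} σ → x ≢ v → erase v (x ∷ σ) ≡ x ∷ erase v σ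
erase-∷-≢ {v} σ x≢v = filter-accept (λ x → ¬? (x ≟ v)) x≢v

erase-∉ : ∀ {v σ} → v ∉ σ → erase v σ ≡ σ
erase-∉ {v} v∉σ = filter-all (λ x → ¬? (x ≟ v)) (All.tabulate (λ x∈σ x≡v → v∉σ (subst (_∈ _) x≡v x∈σ)))

erase-insertPair : ∀ {v} τ {ρ} → v ∉ τ → ρ ∈ insertPair v τ → erase v ρ ≡ τ
erase-insertPair {v} [] _ m rewrite ∈-insertPair-[] m | erase-∷-≡ v (v ∷ []) | erase-∷-≡ v [] = refl
erase-insertPair {v} (t ∷ τ) v∉ m with insertPair-view m
... | front refl rewrite erase-∷-≡ v (v ∷ t ∷ τ) | erase-∷-≡ v (t ∷ τ) = erase-∉ v∉
... | behind {ρ′} m′ refl rewrite erase-∷-≢ ρ′ (λ t≡v → v∉ (here (sym t≡v))) =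
  cong (t ∷_) (erase-insertPair τ (λ m → v∉ (there m)) m′)

ExceedsBefore-∉ : ∀ {v} σ → v ∉ σ → ExceedsBefore v σ
ExceedsBefore-∉ []      _   = tt
ExceedsBefore-∉ (y ∷ σ) v∉ = (λ m → ⊥-elim (v∉ (there m))) , ExceedsBefore-∉ σ (λ m → v∉ (there m))

All<⇒∉ : ∀ {v σ} → All (_< v) σ → v ∉ σ
All<⇒∉ (v<v ∷ _)   (here refl) = n≮n _ v<v
All<⇒∉ (_   ∷ σ<v) (there m)   = All<⇒∉ σ<v m

ExceedsBefore-insertPair : ∀ {t v} τ {ρ} → t < v → ExceedsBefore t τ → ρ ∈ insertPair v τ → ExceedsBefore t ρ
ExceedsBefore-insertPair [] t<v _ m rewrite ∈-insertPair-[] m = (λ _ → t<v) , (λ ()) , tt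
ExceedsBefore-insertPair {t} {v} (s ∷ τ) t<v (h , hs) m with insertPair-view m
... | front refl     = (λ _ → t<v) , (λ _ → t<v) , h , hs
... | behind m′ refl = (λ t∈ρ′ → t<s (∈-insertPair⁻ τ m′ t∈ρ′)) , ExceedsBefore-insertPair τ t<v hs m′
  where
    t<s : t ≡ v ⊎ t ∈ τ → t < s
    t<s (inj₁ refl) = ⊥-elim (n≮n t t<v)
    t<s (inj₂ t∈τ)  = h t∈τ

Stirling-insertPair : ∀ {v} σ → All (_< v) σ → Stirling σ → ∀ {ρ} → ρ ∈ insertPair v σ → Stirling ρ
Stirling-insertPair [] _ _ m rewrite ∈-insertPair-[] m = ((λ ()) , tt) , tt , tt
Stirling-insertPair {v} (t ∷ τ) (t<v ∷ τ<v) (h , st) m with insertPair-view m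
... | front refl     = ((λ m → ⊥-elim (All<⇒∉ (t<v ∷ τ<v) m)) , v-ok) , v-ok , h , st
  where v-ok = ExceedsBefore-∉ (t ∷ τ) (All<⇒∉ (t<v ∷ τ<v))
... | behind m′ refl = ExceedsBefore-insertPair τ t<v h m′ , Stirling-insertPair τ τ<v st m′

ExceedsBefore-erase : ∀ {x} v σ → x ≢ v → ExceedsBefore x σ → ExceedsBefore x (erase v σ)
ExceedsBefore-erase v []      _   _        = tt
ExceedsBefore-erase v (y ∷ σ) x≢v (h , hs) with y ≟ v
... | yes refl rewrite erase-∷-≡ v σ = ExceedsBefore-erase v σ x≢v hs
... | no y≢v   rewrite erase-∷-≢ σ y≢v =
  (λ x∈ → h (proj₁ (∈-filter⁻ (λ x → ¬? (x ≟ v)) {xs = σ} x∈))) , ExceedsBefore-erase v σ x≢v hs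

Stirling-erase : ∀ v σ → Stirling σ → Stirling (erase v σ)
Stirling-erase v []      _        = tt
Stirling-erase v (x ∷ σ) (h , st) with x ≟ v
... | yes refl rewrite erase-∷-≡ v σ = Stirling-erase v σ st
... | no x≢v   rewrite erase-∷-≢ σ x≢v = ExceedsBefore-erase v σ x≢v h , Stirling-erase v σ st

-- In a Stirling word whose largest letter v occurs twice, the two copies of v are adjacent.
∈-insertPair-erase : ∀ v ρ → All (_≤ v) ρ → occ v ρ ≡ 2 → Stirling ρ → ρ ∈ insertPair v (erase v ρ)
∈-insertPair-erase v (x ∷ ρ) (_ ∷ ρ≤v) o (_ , st) with x ≟ v
... | no x≢v rewrite occ-∷-≢ ρ x≢v | erase-∷-≢ ρ x≢v = there (∈-map⁺ (x ∷_) (∈-insertPair-erase v ρ ρ≤v o st))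
∈-insertPair-erase v (x ∷ []) _ o _ | yes refl rewrite occ-∷-≡ v [] with () ← o
∈-insertPair-erase v (x ∷ y ∷ ρ) (_ ∷ y≤v ∷ _) o ((h , _) , _) | yes refl with y ≟ v
... | yes refl rewrite occ-∷-≡ v (v ∷ ρ) | occ-∷-≡ v ρ | erase-∷-≡ v (v ∷ ρ) | erase-∷-≡ v ρ =
  subst (λ τ → (v ∷ v ∷ ρ) ∈ insertPair v τ) (sym (erase-∉ (λ v∈ρ → ∈⇒occ≢0 v∈ρ (suc-injective (suc-injective o)))))
        (pair∈insertPair v ρ)
... | no y≢v rewrite occ-∷-≡ v (y ∷ ρ) | occ-∷-≢ ρ y≢v =
  ⊥-elim (<⇒≱ (h (occ≢0⇒∈ {v} {ρ} (λ occ≡0 → 1+n≢n (trans (sym (suc-injective o)) occ≡0)))) y≤v)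

InRange : ℕ → List ℕ → Set
InRange n σ = All (λ x → 0 < x × x ≤ n) σ

∈-words⁺ : ∀ k n σ → length σ ≡ k → InRange n σ → σ ∈ words k n
∈-words⁺ zero    n []          refl []                 = here refl
∈-words⁺ (suc k) n (suc x ∷ σ) eq   ((_ , x<n) ∷ σ∈n) =
  ∈-concatMap⁺ (λ v → map (v ∷_) (words k n))
    (lose (∈-applyUpTo⁺ suc x<n) (∈-map⁺ (suc x ∷_) (∈-words⁺ k n σ (suc-injective eq) σ∈n)))

∈-words⁻ : ∀ k n σ → σ ∈ words k n → length σ ≡ k × InRange n σ
∈-words⁻ zero    n σ (here refl) = refl , []
∈-words⁻ (suc k) n σ m with x , x∈ , σ∈ ← find (∈-concatMap⁻ (λ v → map (v ∷_) (words k n)) {xs = applyUpTo suc n} m)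
                     with i , i<n , refl ← ∈-applyUpTo⁻ suc x∈ | σ′ , m′ , refl ← ∈-map⁻ (x ∷_) σ∈ =
  let len , σ′∈n = ∈-words⁻ k n σ′ m′ in cong suc len , (s≤s z≤n , i<n) ∷ σ′∈n

∈-Q⁺ : ∀ n σ → InRange n σ → IsStirling n σ → σ ∈ Q n
∈-Q⁺ n σ σ∈n st = ∈-filter⁺ (isStirling? n) (∈-words⁺ (2 * n) n σ (proj₁ (proj₁ st)) σ∈n) st

∈-Q⁻ : ∀ n σ → σ ∈ Q n → InRange n σ × IsStirling n σ
∈-Q⁻ n σ m = let m′ , st = ∈-filter⁻ (isStirling? n) {xs = words (2 * n) n} m in proj₂ (∈-words⁻ (2 * n) n σ m′) , st

∈-Q⇒All< : ∀ n σ → σ ∈ Q n → All (_< suc n) σ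
∈-Q⇒All< n σ m = All.map (λ (_ , x≤n) → s≤s x≤n) (proj₁ (∈-Q⁻ n σ m))

Unique-words : ∀ k n → Unique (words k n)
Unique-words zero    n = [] ∷ []
Unique-words (suc k) n =
  Unique-concatMap (λ v → map (v ∷_) (words k n)) (Unique.applyUpTo⁺₁ suc n (λ i<j _ eq → <⇒≢ i<j (suc-injective eq)))
    (λ _ → Unique.map⁺ ∷-injectiveʳ (Unique-words k n))
    (λ {x} {y} _ _ p q → let _ , _ , eq = ∈-map⁻ (x ∷_) p ; _ , _ , eq′ = ∈-map⁻ (y ∷_) q in ∷-injectiveˡ (trans (sym eq) eq′))

Unique-Q : ∀ n → Unique (Q n)
Unique-Q n = Unique.filter⁺ (isStirling? n) (Unique-words (2 * n) n)

insertPair-∈-Q : ∀ n {σ ρ} → σ ∈ Q n → ρ ∈ insertPair (suc n) σ → ρ ∈ Q (suc n)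
insertPair-∈-Q n {σ} {ρ} σ∈Q m with σ∈n , (len , occs) , sc ← ∈-Q⁻ n σ σ∈Q =
  ∈-Q⁺ (suc n) ρ ρ∈n ((len′ , occs′) , Stirling⇒StirlingCond ρ (Stirling-insertPair σ σ<v (StirlingCond⇒Stirling σ sc) m))
  where
    σ<v : All (_< suc n) σ
    σ<v = ∈-Q⇒All< n σ σ∈Q
    ρ∈n : InRange (suc n) ρ
    ρ∈n = All.tabulate λ z∈ρ → case (∈-insertPair⁻ σ m z∈ρ)
      where
        case : ∀ {z} → z ≡ suc n ⊎ z ∈ σ → 0 < z × z ≤ suc n
        case (inj₁ refl) = s≤s z≤n , ≤-refl
        case (inj₂ z∈σ)  = proj₁ (All.lookup σ∈n z∈σ) , m≤n⇒m≤1+n (proj₂ (All.lookup σ∈n z∈σ))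
    len′ : length ρ ≡ 2 * suc n
    len′ = trans (∈-insertPair⇒length σ m) (trans (cong (λ l → suc (suc l)) len) (sym (*-suc 2 n)))
    occs′ : (i : Fin (suc n)) → occ (suc (toℕ i)) ρ ≡ 2
    occs′ i with toℕ i ≟ n
    ... | yes i≡n rewrite i≡n = trans (occ-insertPair σ m) (cong (λ o → suc (suc o)) (occ-∉ (All<⇒∉ σ<v)))
    ... | no i≢n   = trans (occ-insertPair-≢ σ (λ eq → i≢n (suc-injective eq)) m)
                           (subst (λ j → occ (suc j) σ ≡ 2) (toℕ-fromℕ< i<n) (occs (fromℕ< i<n)))
      where i<n = ≤∧≢⇒< (≤-pred (toℕ<n i)) i≢n

erase-∈-Q : ∀ n {ρ} → ρ ∈ Q (suc n) → erase (suc n) ρ ∈ Q n × ρ ∈ insertPair (suc n) (erase (suc n) ρ)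
erase-∈-Q n {ρ} ρ∈Q with ρ∈n , (len , occs) , sc ← ∈-Q⁻ (suc n) ρ ρ∈Q =
  ∈-Q⁺ n σ σ∈n ((len′ , occs′) , Stirling⇒StirlingCond σ (Stirling-erase (suc n) ρ st)) , ρ∈ins
  where
    σ = erase (suc n) ρ
    st = StirlingCond⇒Stirling ρ sc
    ρ∈ins : ρ ∈ insertPair (suc n) σ
    ρ∈ins = ∈-insertPair-erase (suc n) ρ (All.map proj₂ ρ∈n)
              (subst (λ j → occ (suc j) ρ ≡ 2) (toℕ-fromℕ< (n<1+n n)) (occs (fromℕ< (n<1+n n)))) st
    σ∈n : InRange n σ
    σ∈n = All.tabulate λ z∈σ →
      let z∈ρ , z≢v = ∈-filter⁻ (λ x → ¬? (x ≟ suc n)) {xs = ρ} z∈σ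
          0<z , z≤v = All.lookup ρ∈n z∈ρ
      in 0<z , ≤-pred (≤∧≢⇒< z≤v z≢v)
    len′ : length σ ≡ 2 * n
    len′ = suc-injective (suc-injective (trans (sym (∈-insertPair⇒length σ ρ∈ins)) (trans len (*-suc 2 n))))
    occs′ : (i : Fin n) → occ (suc (toℕ i)) σ ≡ 2
    occs′ i = trans (sym (occ-insertPair-≢ σ (λ eq → <-irrefl (suc-injective eq) (toℕ<n i)) ρ∈ins))
                    (subst (λ j → occ (suc j) ρ ≡ 2) (toℕ-inject₁ i) (occs (inject₁ i)))

#-Q-suc : ∀ n (h : List ℕ → ℕ) k → #[ h ≡ k ] (Q (suc n)) ≡ #[ h ≡ k ] (concatMap (insertPair (suc n)) (Q n))
#-Q-suc n h k = unique-⊆⊇⇒length-filter≡ (λ x → h x ≟ k) (Unique-Q (suc n)) Unique-insertions Q⊆ Q⊇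
  where
    v∉ : ∀ {σ} → σ ∈ Q n → suc n ∉ σ
    v∉ {σ} σ∈Q = All<⇒∉ (∈-Q⇒All< n σ σ∈Q)
    Unique-insertions : Unique (concatMap (insertPair (suc n)) (Q n))
    Unique-insertions = Unique-concatMap (insertPair (suc n)) (Unique-Q n) (λ {σ} σ∈Q → Unique-insertPair σ (v∉ σ∈Q))
      (λ {σ} {τ} σ∈Q τ∈Q ρ∈σ ρ∈τ → trans (sym (erase-insertPair σ (v∉ σ∈Q) ρ∈σ)) (erase-insertPair τ (v∉ τ∈Q) ρ∈τ))
    Q⊆ : ∀ {ρ} → ρ ∈ Q (suc n) → ρ ∈ concatMap (insertPair (suc n)) (Q n)
    Q⊆ ρ∈Q = let σ∈Q , ρ∈ins = erase-∈-Q n ρ∈Q in ∈-concatMap⁺ (insertPair (suc n)) (lose σ∈Q ρ∈ins)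
    Q⊇ : ∀ {ρ} → ρ ∈ concatMap (insertPair (suc n)) (Q n) → ρ ∈ Q (suc n)
    Q⊇ m = let _ , σ∈Q , ρ∈ins = find (∈-concatMap⁻ (insertPair (suc n)) {xs = Q n} m) in insertPair-∈-Q n σ∈Q ρ∈ins

-- Ascent plateaus under pair insertion

<∧≡⇒peak≡1 : ∀ {a b c} → a < b → b ≡ c → peak a b c ≡ 1
<∧≡⇒peak≡1 {a} {b} {c} a<b b≡c with a <? b | b ≟ c
... | yes _  | yes _  = refl
... | no a≮b | _      = ⊥-elim (a≮b a<b)
... | yes _  | no b≢c = ⊥-elim (b≢c b≡c)

≮⇒peak≡0 : ∀ {a b c} → ¬ a < b → peak a b c ≡ 0
≮⇒peak≡0 {a} {b} {c} a≮b with a <? b | b ≟ c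
... | yes a<b | yes _ = ⊥-elim (a≮b a<b)
... | yes _   | no _  = refl
... | no _    | _     = refl

≢⇒peak≡0 : ∀ {a b c} → b ≢ c → peak a b c ≡ 0
≢⇒peak≡0 {a} {b} {c} b≢c with a <? b | b ≟ c
... | yes _ | yes b≡c = ⊥-elim (b≢c b≡c)
... | yes _ | no _    = refl
... | no _  | _       = refl

peak≤1 : ∀ a b c → peak a b c ≤ 1
peak≤1 a b c with a <? b | b ≟ c
... | yes _ | yes _ = ≤-refl
... | yes _ | no _  = z≤n
... | no _  | _     = z≤n

leadPeak : ℕ → ℕ → List ℕ → ℕ
leadPeak a b []      = 0
leadPeak a b (t ∷ _) = peak a b t

ap-∷-∷ : ∀ a b τ → ap (a ∷ b ∷ τ) ≡ leadPeak a b τ + ap (b ∷ τ)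
ap-∷-∷ a b []      = refl
ap-∷-∷ a b (t ∷ τ) = refl

leadPeak-dup : ∀ b τ → leadPeak b b τ ≡ 0
leadPeak-dup b []      = refl
leadPeak-dup b (t ∷ τ) = ≮⇒peak≡0 (n≮n b)

ap-dup : ∀ b τ → ap (b ∷ b ∷ τ) ≡ ap (b ∷ τ)
ap-dup b τ = trans (ap-∷-∷ b b τ) (cong (_+ ap (b ∷ τ)) (leadPeak-dup b τ))

peak+leadPeak≤1 : ∀ a b t τ → peak a b t + leadPeak b t τ ≤ 1
peak+leadPeak≤1 a b t []      = ≤-trans (≤-reflexive (+-identityʳ _)) (peak≤1 a b t)
peak+leadPeak≤1 a b t (s ∷ τ) with a <? b | b ≟ t
... | yes _ | yes refl = ≤-reflexive (cong suc (≮⇒peak≡0 (n≮n b)))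
... | yes _ | no _     = peak≤1 b t s
... | no _  | _        = peak≤1 b t s

ap-larger-∷ : ∀ {v t} τ → t < v → ap (v ∷ t ∷ τ) ≡ ap (t ∷ τ)
ap-larger-∷         []      _   = refl
ap-larger-∷ {t = t} (s ∷ τ) t<v = cong (_+ ap (t ∷ s ∷ τ)) (≮⇒peak≡0 (<⇒≯ t<v))

ap-pair-∷ : ∀ {v} τ → All (_< v) τ → ap (v ∷ v ∷ τ) ≡ ap τ
ap-pair-∷     []      _         = refl
ap-pair-∷ {v} (t ∷ τ) (t<v ∷ _) = trans (ap-dup v (t ∷ τ)) (ap-larger-∷ τ t<v)

ap-after-pair : ∀ a {b v} τ → b < v → All (_< v) τ → ap (a ∷ b ∷ v ∷ v ∷ τ) ≡ suc (ap τ)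
ap-after-pair a {b} τ b<v τ<v rewrite ≢⇒peak≡0 {a} (<⇒≢ b<v) | <∧≡⇒peak≡1 {b} b<v refl = cong suc (ap-pair-∷ τ τ<v)

private
  front-value : ∀ {X Y} p q r → X ≡ suc r → Y ≡ q + r → p + q ≤ 1 → X ≡ p + Y ⊎ X ≡ suc (p + Y)
  front-value 0             0             r refl refl _         = inj₂ refl
  front-value 0             1             r refl refl _         = inj₁ refl
  front-value 1             0             r refl refl _         = inj₁ refl
  front-value 0             (suc (suc q)) r _    _    (s≤s ())
  front-value 1             (suc q)       r _    _    (s≤s ())
  front-value (suc (suc p)) q             r _    _    (s≤s ())

  front-count : ∀ {X Y} p q r → X ≡ suc r → Y ≡ q + r → p + q ≤ 1 → (d : Dec (X ≡ p + Y)) →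
    𝟙 d + (2 * r + q) ≡ 2 * Y + p
  front-count 0             0             r refl refl _ (yes e) = ⊥-elim (1+n≢n e)
  front-count 0             0             r refl refl _ (no _)  = refl
  front-count 0             1             r refl refl _ (yes _) = e r
    where e : ∀ r → 1 + (2 * r + 1) ≡ 2 * (1 + r) + 0
          e = solve-∀
  front-count 0             1             r refl refl _ (no ¬e) = ⊥-elim (¬e refl)
  front-count 1             0             r refl refl _ (yes _) = e r
    where e : ∀ r → 1 + (2 * r + 0) ≡ 2 * (0 + r) + 1
          e = solve-∀
  front-count 1             0             r refl refl _ (no ¬e) = ⊥-elim (¬e refl)
  front-count 0             (suc (suc q)) r _    _    (s≤s ()) _
  front-count 1             (suc q)       r _    _    (s≤s ()) _
  front-count (suc (suc p)) q             r _    _    (s≤s ()) _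

ap-insertPair-TwoValued₂ : ∀ a {b v} τ → b < v → All (_< v) τ →
  TwoValued (λ ρ → ap (a ∷ b ∷ ρ)) (ap (a ∷ b ∷ τ)) (insertPair v τ)
ap-insertPair-TwoValued₂ a [] b<v [] m rewrite ∈-insertPair-[] m = inj₂ (ap-after-pair a [] b<v [])
ap-insertPair-TwoValued₂ a {b} (t ∷ τ) b<v (t<v ∷ τ<v) m with insertPair-view m
... | front refl     = front-value (peak a b t) (leadPeak b t τ) (ap (t ∷ τ))
                         (ap-after-pair a (t ∷ τ) b<v (t<v ∷ τ<v)) (ap-∷-∷ b t τ) (peak+leadPeak≤1 a b t τ)
... | behind m′ refl = Sum.map (cong (peak a b t +_)) (λ e → trans (cong (peak a b t +_) e) (+-suc _ _))
                         (ap-insertPair-TwoValued₂ b τ t<v τ<v m′)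

#-ap-insertPair₂ : ∀ a {b v} τ → b < v → All (_< v) τ →
  #[ (λ ρ → ap (a ∷ b ∷ ρ)) ≡ ap (a ∷ b ∷ τ) ] (insertPair v τ) ≡ 2 * ap (b ∷ τ) + leadPeak a b τ
#-ap-insertPair₂ a {b} {v} [] b<v [] = trans (#-∷ (λ ρ → ap (a ∷ b ∷ ρ)) 0 (v ∷ v ∷ []) [])
  (cong (_+ 0) (𝟙-≢ (λ e → 0≢1+n (trans (sym e) (ap-after-pair a [] b<v [])))))
#-ap-insertPair₂ a {b} {v} (t ∷ τ) b<v (t<v ∷ τ<v) = begin
  #[ h ≡ o ] ((v ∷ v ∷ t ∷ τ) ∷ map (t ∷_) ins)
    ≡⟨ #-∷ h o (v ∷ v ∷ t ∷ τ) (map (t ∷_) ins) ⟩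
  atFront + #[ h ≡ o ] (map (t ∷_) ins)
    ≡⟨ cong (atFront +_) (#-map h (t ∷_) o ins) ⟩
  atFront + #[ (λ ρ → peak a b t + ap (b ∷ t ∷ ρ)) ≡ peak a b t + ap (b ∷ t ∷ τ) ] ins
    ≡⟨ cong (atFront +_) (#-+ˡ (λ ρ → ap (b ∷ t ∷ ρ)) (peak a b t) (ap (b ∷ t ∷ τ)) ins) ⟩
  atFront + #[ (λ ρ → ap (b ∷ t ∷ ρ)) ≡ ap (b ∷ t ∷ τ) ] ins
    ≡⟨ cong (atFront +_) (#-ap-insertPair₂ b τ t<v τ<v) ⟩
  atFront + (2 * ap (t ∷ τ) + leadPeak b t τ)
    ≡⟨ front-count (peak a b t) (leadPeak b t τ) (ap (t ∷ τ)) (ap-after-pair a (t ∷ τ) b<v (t<v ∷ τ<v))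
                   (ap-∷-∷ b t τ) (peak+leadPeak≤1 a b t τ) (h (v ∷ v ∷ t ∷ τ) ≟ o) ⟩
  2 * ap (b ∷ t ∷ τ) + peak a b t
    ∎
  where
    open ≡-Reasoning
    ins = insertPair v τ
    h = λ ρ → ap (a ∷ b ∷ ρ)
    o = ap (a ∷ b ∷ t ∷ τ)
    atFront = 𝟙 (h (v ∷ v ∷ t ∷ τ) ≟ o)

ap-insertPair-TwoValued₁ : ∀ {b v} τ → b < v → All (_< v) τ →
  TwoValued (λ ρ → ap (b ∷ ρ)) (ap (b ∷ τ)) (insertPair v τ)
ap-insertPair-TwoValued₁ {b} τ b<v τ<v {ρ} m =
  subst₂ (λ x y → x ≡ y ⊎ x ≡ suc y) (ap-dup b ρ) (ap-dup b τ) (ap-insertPair-TwoValued₂ b τ b<v τ<v m)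

#-ap-insertPair₁ : ∀ {b v} τ → b < v → All (_< v) τ →
  #[ (λ ρ → ap (b ∷ ρ)) ≡ ap (b ∷ τ) ] (insertPair v τ) ≡ 2 * ap (b ∷ τ)
#-ap-insertPair₁ {b} {v} τ b<v τ<v = begin
  #[ (λ ρ → ap (b ∷ ρ)) ≡ ap (b ∷ τ) ] (insertPair v τ)
    ≡⟨ #-cong (λ ρ → ap (b ∷ ρ)) (λ ρ → sym (ap-dup b ρ)) (sym (ap-dup b τ)) (insertPair v τ) ⟩
  #[ (λ ρ → ap (b ∷ b ∷ ρ)) ≡ ap (b ∷ b ∷ τ) ] (insertPair v τ) ≡⟨ #-ap-insertPair₂ b τ b<v τ<v ⟩
  2 * ap (b ∷ τ) + leadPeak b b τ                               ≡⟨ cong (2 * ap (b ∷ τ) +_) (leadPeak-dup b τ) ⟩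
  2 * ap (b ∷ τ) + 0                                            ≡⟨ +-identityʳ _ ⟩
  2 * ap (b ∷ τ)                                                ∎
  where open ≡-Reasoning

ap-insertPair-TwoValued : ∀ {v} σ → All (_< v) σ → TwoValued ap (ap σ) (insertPair v σ)
ap-insertPair-TwoValued []      []          m rewrite ∈-insertPair-[] m = inj₁ refl
ap-insertPair-TwoValued (t ∷ τ) (t<v ∷ τ<v) m with insertPair-view m
... | front refl     = inj₁ (ap-pair-∷ (t ∷ τ) (t<v ∷ τ<v))
... | behind m′ refl = ap-insertPair-TwoValued₁ τ t<v τ<v m′

#-ap-insertPair : ∀ {v} σ → All (_< v) σ → #[ ap ≡ ap σ ] (insertPair v σ) ≡ suc (2 * ap σ)
#-ap-insertPair     []      []          = refl
#-ap-insertPair {v} (t ∷ τ) (t<v ∷ τ<v) =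
  trans (#-∷ ap (ap (t ∷ τ)) (v ∷ v ∷ t ∷ τ) (map (t ∷_) (insertPair v τ)))
        (cong₂ _+_ (𝟙-≡ (ap-pair-∷ (t ∷ τ) (t<v ∷ τ<v)))
                   (trans (#-map ap (t ∷_) (ap (t ∷ τ)) (insertPair v τ)) (#-ap-insertPair₁ τ t<v τ<v)))

-- Recurrences for M and N

module _ (n : ℕ) {σ : List ℕ} (σ∈Q : σ ∈ Q n) where

  ap-ChildProfile : ChildProfile ap (insertPair (suc n)) (suc (2 * n)) (λ o → suc (2 * o)) σ
  ap-ChildProfile = trans (length-insertPair (suc n) σ) (cong suc (proj₁ (proj₁ (proj₂ (∈-Q⁻ n σ σ∈Q))))) ,
                    ap-insertPair-TwoValued σ (∈-Q⇒All< n σ σ∈Q) ,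
                    #-ap-insertPair σ (∈-Q⇒All< n σ σ∈Q)

  lap-ChildProfile : ChildProfile lap (insertPair (suc n)) (suc (2 * n)) (2 *_) σ
  lap-ChildProfile = proj₁ ap-ChildProfile ,
                     ap-insertPair-TwoValued₁ σ (s≤s z≤n) (∈-Q⇒All< n σ σ∈Q) ,
                     #-ap-insertPair₁ σ (s≤s z≤n) (∈-Q⇒All< n σ σ∈Q)

M-rec-zero : ∀ n → M (suc n) 0 ≡ M n 0 * 1
M-rec-zero n = trans (#-Q-suc n ap 0)
  (#-concatMap-zero ap (insertPair (suc n)) (suc (2 * n)) (λ o → suc (2 * o)) (Q n) (ap-ChildProfile n))

M-rec-suc : ∀ n k → M (suc n) (suc k) ≡ M n (suc k) * suc (2 * suc k) + M n k * (2 * n ∸ 2 * k)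
M-rec-suc n k = trans (#-Q-suc n ap (suc k))
  (#-concatMap-suc ap (insertPair (suc n)) (suc (2 * n)) (λ o → suc (2 * o)) k (Q n) (ap-ChildProfile n))

N-rec-zero : ∀ n → N (suc n) 0 ≡ N n 0 * 0
N-rec-zero n = trans (#-Q-suc n lap 0)
  (#-concatMap-zero lap (insertPair (suc n)) (suc (2 * n)) (2 *_) (Q n) (lap-ChildProfile n))

N-rec-suc : ∀ n k → N (suc n) (suc k) ≡ N n (suc k) * (2 * suc k) + N n k * (suc (2 * n) ∸ 2 * k)
N-rec-suc n k = trans (#-Q-suc n lap (suc k))
  (#-concatMap-suc lap (insertPair (suc n)) (suc (2 * n)) (2 *_) k (Q n) (lap-ChildProfile n))

-- Alternatingly increasing sequences

-- The chain of AltIncreasing indexed by complementary pairs i + j = d, which avoids truncated subtraction.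
AltIncreasing′ : (ℕ → ℕ) → ℕ → Set
AltIncreasing′ f d = (∀ i j → i + j ≡ d → i < j → f i ≤ f j) × (∀ i j → i + j ≡ d → suc i < j → f j ≤ f (suc i))

AltIncreasing′-zero : ∀ f → AltIncreasing′ f 0
AltIncreasing′-zero f = (λ i j eq i<j → ⊥-elim (n≮0 (subst (i <_) (m+n≡0⇒n≡0 i eq) i<j))) ,
                        (λ i j eq i<j → ⊥-elim (n≮0 (subst (suc i <_) (m+n≡0⇒n≡0 i eq) i<j)))

private
  recurrence-mono₁ : ∀ j r A u v w z → u ≤ v → v ≤ w → w ≤ z →
    (2 * suc j + A) * w + (2 * suc r + 1 + A) * u ≤ (2 * suc r + A) * v + (2 * suc j + 1 + A) * z
  recurrence-mono₁ j r A u v w z u≤v v≤w w≤z = begin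
    (2 * suc j + A) * w + (2 * suc r + 1 + A) * u   ≡⟨ e₁ j r A u w ⟩
    (2 * suc j + A) * w + (u + (2 * suc r + A) * u) ≤⟨ +-mono-≤ (*-monoʳ-≤ (2 * suc j + A) w≤z)
                                                         (+-mono-≤ (≤-trans u≤v (≤-trans v≤w w≤z)) (*-monoʳ-≤ (2 * suc r + A) u≤v)) ⟩
    (2 * suc j + A) * z + (z + (2 * suc r + A) * v) ≡⟨ e₂ j r A v z ⟩
    (2 * suc r + A) * v + (2 * suc j + 1 + A) * z   ∎
    where
      open ≤-Reasoning
      e₁ : ∀ j r A u w → (2 * suc j + A) * w + (2 * suc r + 1 + A) * u ≡ (2 * suc j + A) * w + (u + (2 * suc r + A) * u)
      e₁ = solve-∀
      e₂ : ∀ j r A v z → (2 * suc j + A) * z + (z + (2 * suc r + A) * v) ≡ (2 * suc r + A) * v + (2 * suc j + 1 + A) * z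
      e₂ = solve-∀

  recurrence-mono₂ : ∀ i s A a b e g → a ≤ b → b ≤ e → e ≤ g →
    (2 * suc s + A) * a + (2 * i + 1 + A) * e ≤ (2 * suc i + A) * g + (2 * s + 1 + A) * b
  recurrence-mono₂ i s A a b e g a≤b b≤e e≤g = begin
    (2 * suc s + A) * a + (2 * i + 1 + A) * e     ≡⟨ e₁ i s A a e ⟩
    (2 * s + 1 + A) * a + a + (2 * i + 1 + A) * e ≤⟨ +-mono-≤ (+-mono-≤ (*-monoʳ-≤ (2 * s + 1 + A) a≤b) (≤-trans a≤b (≤-trans b≤e e≤g)))
                                                       (*-monoʳ-≤ (2 * i + 1 + A) e≤g) ⟩
    (2 * s + 1 + A) * b + g + (2 * i + 1 + A) * g ≡⟨ e₂ i s A b g ⟩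
    (2 * suc i + A) * g + (2 * s + 1 + A) * b     ∎
    where
      open ≤-Reasoning
      e₁ : ∀ i s A a e → (2 * suc s + A) * a + (2 * i + 1 + A) * e ≡ (2 * s + 1 + A) * a + a + (2 * i + 1 + A) * e
      e₁ = solve-∀
      e₂ : ∀ i s A b g → (2 * s + 1 + A) * b + g + (2 * i + 1 + A) * g ≡ (2 * suc i + A) * g + (2 * s + 1 + A) * b
      e₂ = solve-∀

AltIncreasing′-rec : ∀ A (c f : ℕ → ℕ) m → (∀ k → m < k → c k ≡ 0) → AltIncreasing′ c m → f 0 ≡ A * c 0 →
  (∀ k l → k + l ≡ m → f (suc k) ≡ (2 * suc k + A) * c (suc k) + (2 * l + 1 + A) * c k) → AltIncreasing′ f (suc m)
AltIncreasing′-rec A c f m c-vanishes (c-inc₁ , c-inc₂) f0 f-rec = f-inc₁ , f-inc₂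
  where
    c0≤cm : c 0 ≤ c m
    c0≤cm with m≤n⇒m<n∨m≡n (z≤n {m})
    ... | inj₁ 0<m = c-inc₁ 0 m refl 0<m
    ... | inj₂ 0≡m = ≤-reflexive (cong c 0≡m)
    f-inc₁ : ∀ i j → i + j ≡ suc m → i < j → f i ≤ f j
    f-inc₁ zero .(suc m) refl _ rewrite f0 | f-rec m 0 (+-identityʳ m) | c-vanishes (suc m) ≤-refl | *-zeroʳ (2 * suc m + A) =
      ≤-trans (*-monoʳ-≤ A c0≤cm) (m≤n+m (A * c m) (c m))
    f-inc₁ (suc j) (suc r) eq (s≤s j<r) = subst₂ _≤_ (sym (f-rec j (suc r) j+1+r≡m)) (sym (f-rec r (suc j) r+1+j≡m))
      (recurrence-mono₁ j r A (c j) (c (suc r)) (c (suc j)) (c r)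
        (c-inc₁ j (suc r) j+1+r≡m (m<n⇒m<1+n j<r)) (c-inc₂ j (suc r) j+1+r≡m (s≤s j<r)) c[j+1]≤c[r])
      where
        j+1+r≡m : j + suc r ≡ m
        j+1+r≡m = suc-injective eq
        r+1+j≡m : r + suc j ≡ m
        r+1+j≡m = trans (+-suc r j) (trans (cong suc (+-comm r j)) (trans (sym (+-suc j r)) j+1+r≡m))
        c[j+1]≤c[r] : c (suc j) ≤ c r
        c[j+1]≤c[r] with m≤n⇒m<n∨m≡n j<r
        ... | inj₁ j+1<r = c-inc₁ (suc j) r (trans (sym (+-suc j r)) j+1+r≡m) j+1<r
        ... | inj₂ refl  = ≤-refl
    f-inc₂ : ∀ i j → i + j ≡ suc m → suc i < j → f j ≤ f (suc i)
    f-inc₂ i (suc s) eq (s≤s i<s) = subst₂ _≤_ (sym (f-rec s i s+i≡m)) (sym (f-rec i s i+s≡m))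
      (recurrence-mono₂ i s A (c (suc s)) (c i) (c s) (c (suc i)) c[s+1]≤c[i] (c-inc₁ i s i+s≡m i<s) c[s]≤c[i+1])
      where
        i+s≡m : i + s ≡ m
        i+s≡m = suc-injective (trans (sym (+-suc i s)) eq)
        s+i≡m : s + i ≡ m
        s+i≡m = trans (+-comm s i) i+s≡m
        c[s+1]≤c[i] : c (suc s) ≤ c i
        c[s+1]≤c[i] = from-end i i+s≡m i<s
          where
            from-end : ∀ i → i + s ≡ m → i < s → c (suc s) ≤ c i
            from-end zero    s≡m _   = ≤-trans (≤-reflexive (c-vanishes (suc s) (s≤s (≤-reflexive (sym s≡m))))) z≤n
            from-end (suc t) eq  t<s = c-inc₂ t (suc s) (trans (+-suc t s) eq) (m<n⇒m<1+n t<s)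
        c[s]≤c[i+1] : c s ≤ c (suc i)
        c[s]≤c[i+1] with m≤n⇒m<n∨m≡n i<s
        ... | inj₁ i+1<s = c-inc₂ i s i+s≡m i+1<s
        ... | inj₂ refl  = ≤-refl

private
  partner : ∀ i {d} k → i + k ≤ d → i + (d ∸ i) ≡ d × k ≤ d ∸ i
  partner i {d} k i+k≤d = m+[n∸m]≡n (m+n≤o⇒m≤o i i+k≤d) , m+n≤o⇒m≤o∸n k (subst (_≤ d) (+-comm i k) i+k≤d)

  2i+1≡i+[1+i] : ∀ i → 2 * i + 1 ≡ i + suc i
  2i+1≡i+[1+i] = solve-∀

  2i+2≡i+[2+i] : ∀ i → 2 * i + 2 ≡ i + suc (suc i)
  2i+2≡i+[2+i] = solve-∀

AltIncreasing′⇒AltIncreasing : ∀ f d → AltIncreasing′ f d → AltIncreasing f d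
AltIncreasing′⇒AltIncreasing f d (inc₁ , inc₂) = chain₁ , chain₂
  where
    chain₁ : ∀ i → 2 * i + 1 ≤ d → f i ≤ f (d ∸ i)
    chain₁ i le = let eq , i<j = partner i (suc i) (subst (_≤ d) (2i+1≡i+[1+i] i) le) in inc₁ i (d ∸ i) eq i<j
    chain₂ : ∀ i → 2 * i + 2 ≤ d → f (d ∸ i) ≤ f (suc i)
    chain₂ i le = let eq , i+1<j = partner i (suc (suc i)) (subst (_≤ d) (2i+2≡i+[2+i] i) le) in inc₂ i (d ∸ i) eq i+1<j

private
  middle-bounds : ∀ d → 2 * ((d + 1) / 2) ≤ d + 1 × d ≤ 2 * ((d + 1) / 2)
  middle-bounds d = subst (_≤ d + 1) (*-comm h 2) (m/n*n≤m (d + 1) 2) ,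
                    ≤-pred (subst₂ _≤_ (+-comm d 1) (cong suc (*-comm h 2)) d+1≤1+2h)
    where
      h = (d + 1) / 2
      d+1≤1+2h : d + 1 ≤ 1 + h * 2
      d+1≤1+2h = begin
        d + 1               ≡⟨ m≡m%n+[m/n]*n (d + 1) 2 ⟩
        (d + 1) % 2 + h * 2 ≤⟨ +-monoˡ-≤ (h * 2) (≤-pred (m%n<n (d + 1) 2)) ⟩
        1 + h * 2           ∎
        where open ≤-Reasoning

AltIncreasing′⇒UnimodalWithMode : ∀ f d → AltIncreasing′ f d → UnimodalWithMode f d ((d + 1) / 2)
AltIncreasing′⇒UnimodalWithMode f d (inc₁ , inc₂) = h≤d , rising , falling
  where
    h = (d + 1) / 2
    below-middle : ∀ i → i < h → 2 * i + 1 ≤ d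
    below-middle i i<h = ≤-pred (subst₂ _≤_ (e i) (+-comm d 1) (≤-trans (*-monoʳ-≤ 2 i<h) (proj₁ (middle-bounds d))))
      where e : ∀ i → 2 * suc i ≡ suc (2 * i + 1)
            e = solve-∀
    h≤d : h ≤ d
    h≤d with h in eq
    ... | zero  = z≤n
    ... | suc x = ≤-trans (s≤s (m≤m+n x (x + 0))) (subst (_≤ d) (+-comm (2 * x) 1) (below-middle x (subst (x <_) (sym eq) ≤-refl)))
    rising : ∀ i → i < h → f i ≤ f (suc i)
    rising i i<h with eq , i<j ← partner i (suc i) (subst (_≤ d) (2i+1≡i+[1+i] i) (below-middle i i<h))
                 with m≤n⇒m<n∨m≡n i<j
    ... | inj₁ i+1<j = ≤-trans (inc₁ i (d ∸ i) eq i<j) (inc₂ i (d ∸ i) eq i+1<j)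
    ... | inj₂ i+1≡j = subst (λ x → f i ≤ f x) (sym i+1≡j) (inc₁ i (d ∸ i) eq i<j)
    falling : ∀ i → h ≤ i → i < d → f (suc i) ≤ f i
    falling i h≤i i<d = Sum.[ (λ j+1<i → ≤-trans f[i+1]≤f[j+1] (inc₁ (suc j) i (trans (sym (+-suc j i)) j+[1+i]≡d) j+1<i)) ,
                              (λ j+1≡i → subst (λ x → f (suc i) ≤ f x) j+1≡i f[i+1]≤f[j+1]) ] (m≤n⇒m<n∨m≡n j+1≤i)
      where
        j = d ∸ suc i
        j+[1+i]≡d : j + suc i ≡ d
        j+[1+i]≡d = trans (+-comm j (suc i)) (m+[n∸m]≡n i<d)
        j+1≤i : suc j ≤ i
        j+1≤i = +-cancelˡ-≤ i (suc j) i (subst₂ _≤_ (trans (sym j+[1+i]≡d) (e₁ i j)) (e₂ i)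
                                          (≤-trans (proj₂ (middle-bounds d)) (*-monoʳ-≤ 2 h≤i)))
          where e₁ : ∀ i j → j + suc i ≡ i + suc j
                e₁ = solve-∀
                e₂ : ∀ i → 2 * i ≡ i + i
                e₂ = solve-∀
        f[i+1]≤f[j+1] : f (suc i) ≤ f (suc j)
        f[i+1]≤f[j+1] = inc₂ j (suc i) j+[1+i]≡d (s≤s j+1≤i)

AltIncreasing′⇒AltIncAndMiddleMode : ∀ f D → AltIncreasing′ f D → f D ≢ 0 → (∀ k → D < k → f k ≡ 0) →
  AltIncAndMiddleMode f
AltIncreasing′⇒AltIncAndMiddleMode f D alt fD≢0 f-vanishes d (fd≢0 , f-vanishes′) with <-cmp d D
... | tri< d<D _ _  = ⊥-elim (fD≢0 (f-vanishes′ D d<D))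
... | tri> _ _ D<d  = ⊥-elim (fd≢0 (f-vanishes d D<d))
... | tri≈ _ refl _ = AltIncreasing′⇒AltIncreasing f d alt , AltIncreasing′⇒UnimodalWithMode f d alt

N-vanishes : ∀ n k → n < k → N n k ≡ 0
N-vanishes zero    (suc k) _         = refl
N-vanishes (suc n) (suc k) (s≤s n<k) = trans (N-rec-suc n k)
  (cong₂ (λ x y → x * (2 * suc k) + y * (suc (2 * n) ∸ 2 * k)) (N-vanishes n (suc k) (m<n⇒m<1+n n<k)) (N-vanishes n k n<k))

N-top : ∀ n → N n n ≡ 1
N-top zero    = refl
N-top (suc n) = begin
  N (suc n) (suc n)                                               ≡⟨ N-rec-suc n n ⟩
  N n (suc n) * (2 * suc n) + N n n * (suc (2 * n) ∸ 2 * n)       ≡⟨ cong₂ (λ x y → x * (2 * suc n) + y * (suc (2 * n) ∸ 2 * n))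
                                                                            (N-vanishes n (suc n) ≤-refl) (N-top n) ⟩
  1 * (suc (2 * n) ∸ 2 * n)                                       ≡⟨ *-identityˡ _ ⟩
  suc (2 * n) ∸ 2 * n                                             ≡⟨ m+n∸n≡m 1 (2 * n) ⟩
  1                                                               ∎
  where open ≡-Reasoning

N-alt : ∀ n → AltIncreasing′ (N n) n
N-alt zero    = AltIncreasing′-zero (N 0)
N-alt (suc n) = AltIncreasing′-rec 0 (N n) (N (suc n)) n (N-vanishes n) (N-alt n) (trans (N-rec-zero n) (*-comm (N n 0) 0)) rec
  where
    rec : ∀ k l → k + l ≡ n → N (suc n) (suc k) ≡ (2 * suc k + 0) * N n (suc k) + (2 * l + 1 + 0) * N n k
    rec k l refl = trans (N-rec-suc (k + l) k) (trans (cong (λ x → N (k + l) (suc k) * (2 * suc k) + N (k + l) k * x) gap)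
                                                      (e k l (N (k + l) (suc k)) (N (k + l) k)))
      where
        gap : suc (2 * (k + l)) ∸ 2 * k ≡ 2 * l + 1
        gap = trans (cong (_∸ 2 * k) (e′ k l)) (m+n∸m≡n (2 * k) (2 * l + 1))
          where e′ : ∀ k l → suc (2 * (k + l)) ≡ 2 * k + (2 * l + 1)
                e′ = solve-∀
        e : ∀ k l x y → x * (2 * suc k) + y * (2 * l + 1) ≡ (2 * suc k + 0) * x + (2 * l + 1 + 0) * y
        e = solve-∀

M-vanishes : ∀ m k → m < k → M (suc m) k ≡ 0
M-vanishes zero    (suc k) _         = trans (M-rec-suc 0 k)
  (trans (cong (λ y → M 0 (suc k) * suc (2 * suc k) + M 0 k * y) (0∸n≡0 (2 * k))) (*-zeroʳ (M 0 k)))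
M-vanishes (suc m) (suc k) (s≤s m<k) = trans (M-rec-suc (suc m) k)
  (cong₂ (λ x y → x * suc (2 * suc k) + y * (2 * suc m ∸ 2 * k)) (M-vanishes m (suc k) (m<n⇒m<1+n m<k)) (M-vanishes m k m<k))

M-top-pos : ∀ m → 0 < M (suc m) m
M-top-pos zero    = s≤s z≤n
M-top-pos (suc m) = begin-strict
  0                                                                    <⟨ M-top-pos m ⟩
  M (suc m) m                                                          ≤⟨ m≤m*n (M (suc m) m) 2 ⟩
  M (suc m) m * 2                                                      ≡⟨ cong (M (suc m) m *_) (sym (m+n∸n≡m 2 (2 * m))) ⟩
  M (suc m) m * (2 + 2 * m ∸ 2 * m)                                    ≡⟨ cong (λ y → M (suc m) m * (y ∸ 2 * m)) (sym (*-suc 2 m)) ⟩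
  M (suc m) m * (2 * suc m ∸ 2 * m)                                    ≡⟨ cong (λ x → x * suc (2 * suc m) + M (suc m) m * (2 * suc m ∸ 2 * m))
                                                                               (M-vanishes m (suc m) ≤-refl) ⟨
  M (suc m) (suc m) * suc (2 * suc m) + M (suc m) m * (2 * suc m ∸ 2 * m) ≡⟨ M-rec-suc (suc m) m ⟨
  M (suc (suc m)) (suc m)                                              ∎
  where open ≤-Reasoning

M-alt : ∀ m → AltIncreasing′ (M (suc m)) m
M-alt zero    = AltIncreasing′-zero (M 1)
M-alt (suc m) = AltIncreasing′-rec 1 (M (suc m)) (M (suc (suc m))) m (M-vanishes m) (M-alt m)
                  (trans (M-rec-zero (suc m)) (*-comm (M (suc m) 0) 1)) rec
  where
    rec : ∀ k l → k + l ≡ m → M (suc (suc m)) (suc k) ≡ (2 * suc k + 1) * M (suc m) (suc k) + (2 * l + 1 + 1) * M (suc m) k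
    rec k l refl = trans (M-rec-suc (suc (k + l)) k)
                         (trans (cong (λ x → M (suc (k + l)) (suc k) * suc (2 * suc k) + M (suc (k + l)) k * x) gap)
                                (e k l (M (suc (k + l)) (suc k)) (M (suc (k + l)) k)))
      where
        gap : 2 * suc (k + l) ∸ 2 * k ≡ 2 * l + 1 + 1
        gap = trans (cong (_∸ 2 * k) (e′ k l)) (m+n∸m≡n (2 * k) (2 * l + 1 + 1))
          where e′ : ∀ k l → 2 * suc (k + l) ≡ 2 * k + (2 * l + 1 + 1)
                e′ = solve-∀
        e : ∀ k l x y → x * suc (2 * suc k) + y * (2 * l + 1 + 1) ≡ (2 * suc k + 1) * x + (2 * l + 1 + 1) * y
        e = solve-∀

theorem2p7 : (n : ℕ) → n ≥ 1 → AltIncAndMiddleMode (M n) × AltIncAndMiddleMode (N n)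
theorem2p7 (suc m) _ =
  AltIncreasing′⇒AltIncAndMiddleMode (M (suc m)) m (M-alt m) (λ eq → <⇒≢ (M-top-pos m) (sym eq)) (M-vanishes m) ,
  AltIncreasing′⇒AltIncAndMiddleMode (N (suc m)) (suc m) (N-alt (suc m))
    (λ eq → 1+n≢n (trans (sym (N-top (suc m))) eq)) (N-vanishes (suc m))
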